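{- Let $T$ be a tree on $n$ vertices with diameter $d\geq 4$. If $d$ is even, then \[ d \leq l(T)\leq \left\lfloor \frac{(d-2)n+2}{d-1}\right\rfloor; \] if $d$ is odd, then \[ d \leq l(T)\leq \left\lfloor \frac{(d-3)n+4}{d-2}\right\rfloor. \]
   Context: A linear forest in a graph $G$ is a subgraph that is a vertex-disjoint union of (simple) paths. $l(G)$ denotes the maximum number of edges in a linear forest of $G$. -}

module Defs where

open import Data.Nat using (ℕ; zero; suc; _+_; _*_; _∸_; _≤_; _<_)
open import Data.Nat.DivMod using (_/_)
open import Data.Fin using (Fin)
open import Data.List using (List; []; _∷_; _++_; [_]; length; concat; map)
open import Data.Nat.ListAction using (sum)
open import Data.List.Relation.Unary.Linked using (Linked)
open import Data.List.Relation.Unary.Unique.Propositional using (Unique)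
open import Data.List.Relation.Unary.All using (All)
open import Data.Product using (Σ; ∃; _×_)
open import Relation.Nullary using (¬_; Dec)

record Graph (n : ℕ) : Set₁ where
  field
    Adj    : Fin n → Fin n → Set
    adj?   : ∀ u v → Dec (Adj u v)
    sym    : ∀ {u v} → Adj u v → Adj v u
    irrefl : ∀ {u} → ¬ Adj u u
open Graph public

module _ {n : ℕ} (G : Graph n) where

  data Walk : Fin n → Fin n → ℕ → Set where
    here : ∀ {u} → Walk u u 0
    step : ∀ {u v w k} → Adj G u v → Walk v w k → Walk u w (suc k)

  Connected : Set
  Connected = ∀ u v → ∃ λ k → Walk u v k

  IsCycle : Fin n → List (Fin n) → Set
  IsCycle u ys = Unique (u ∷ ys) × 2 ≤ length ys × Linked (Adj G) (u ∷ ys ++ [ u ])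

  Acyclic : Set
  Acyclic = ∀ u ys → ¬ IsCycle u ys

  IsTree : Set
  IsTree = Connected × Acyclic

  Dist : Fin n → Fin n → ℕ → Set
  Dist u v k = Walk u v k × (∀ j → j < k → ¬ Walk u v j)

  IsDiameter : ℕ → Set
  IsDiameter d = (∃ λ u → ∃ λ v → Dist u v d) × (∀ u v k → Dist u v k → k ≤ d)

  -- A walk-sequence in G (consecutive vertices adjacent); distinctness of its
  -- vertices is imposed in LinearForest via Unique (concat paths), making it a path.
  IsPath : List (Fin n) → Set
  IsPath p = Linked (Adj G) p

  record LinearForest : Set where
    field
      paths    : List (List (Fin n))
      arePaths : All IsPath paths
      disjoint : Unique (concat paths)

  edges : LinearForest → ℕ
  edges F = sum (map (λ p → length p ∸ 1) (LinearForest.paths F))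

  -- l(G) ≥ m  and  l(G) ≤ m, with l(G) the maximum number of edges of a linear forest
  lAtLeast : ℕ → Set
  lAtLeast m = Σ LinearForest λ F → m ≤ edges F

  lAtMost : ℕ → Set
  lAtMost m = ∀ (F : LinearForest) → edges F ≤ m

-- evenBound d n = ⌊((d-2)n+2)/(d-1)⌋ (for d ≥ 2; written with d = k+2)
evenBound : ℕ → ℕ → ℕ
evenBound (suc (suc k)) n = (k * n + 2) / suc k
evenBound _ _ = 0

-- oddBound d n = ⌊((d-3)n+4)/(d-2)⌋ (for d ≥ 3; written with d = k+3)
oddBound : ℕ → ℕ → ℕ
oddBound (suc (suc (suc k))) n = (k * n + 4) / suc k
oddBound _ _ = 0

-- A simple walk in a tree is a shortest walk, so it has at most d edges. Two disjoint paths
-- P, Q of a linear forest are joined by a bridge meeting them only at its ends; a subpath of P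
-- ending at the bridge and covering half of P, the bridge, and such a subpath of Q form a simple
-- walk. Call a path long if it has at least 2⌊d/2⌋ vertices. Then for even d two long paths
-- cannot coexist, while for odd d two long paths are adjacent and have at most d vertices each,
-- and three cannot coexist. With k = d − 2 (even) or k = d − 3 (odd), a path on p vertices
-- satisfies (k + 1)(p − 1) ≤ k p + (p ∸ (k + 1)); summing, (k + 1) l ≤ k n + 2 (even) or
-- k n + 4 (odd). The lower bound is a diametral path.

module Submission where

open import Defs hiding (sym)
open import Data.Nat using (ℕ; zero; suc; _+_; _*_; _∸_; _≤_; _<_; _%_; z≤n; s≤s)
open import Data.Nat.Properties
open import Data.Nat.DivMod using (_/_; m*n/n≡m; /-monoˡ-≤; m≡m%n+[m/n]*n)
open import Data.Nat.ListAction using (sum)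
open import Data.Nat.Solver using (module +-*-Solver)
open import Data.Fin using (Fin)
open import Data.Fin.Properties using () renaming (_≟_ to _≟ᶠ_)
open import Data.List using (List; []; _∷_; _++_; [_]; length; concat; map)
open import Data.List.Properties using (length-++; length-tabulate; ++-identityʳ)
open import Data.List.Relation.Unary.Linked using (Linked; [-]; _∷_)
open import Data.List.Relation.Unary.Unique.Propositional using (Unique)
open import Data.List.Relation.Unary.Unique.Propositional.Properties using (++⁺)
open import Data.List.Relation.Unary.AllPairs using (AllPairs; []; _∷_)
open import Data.List.Relation.Unary.All as All using (All; []; _∷_)
open import Data.List.Relation.Unary.All.Properties using (¬Any⇒All¬; ++⁻ˡ; ++⁻ʳ)
open import Data.List.Relation.Unary.Any as Any using (Any; here; there)
open import Data.List.Membership.Propositional using (_∈_; _∉_; find)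
open import Data.List.Membership.Propositional.Properties
  using (∈-++⁺ˡ; ∈-++⁺ʳ; ∈-++⁻; ∈-∃++; ∈-allFin; ∈-concat⁺′)
open import Data.List.Relation.Binary.Disjoint.Propositional using (Disjoint)
open import Data.List.Relation.Binary.Disjoint.Propositional.Properties using () renaming (sym to Disjoint-sym)
open import Data.List.Relation.Binary.Subset.Propositional using (_⊆_)
open import Data.Product using (Σ; ∃; ∃₂; _×_; _,_; proj₁; proj₂; uncurry)
open import Data.Sum using (_⊎_; inj₁; inj₂; [_,_]′)
open import Function using (_∘_)
open import Data.Empty using (⊥; ⊥-elim)
open import Relation.Nullary using (¬_; Dec; yes; no)
open import Relation.Binary.PropositionalEquality
  using (_≡_; refl; sym; trans; cong; cong₂; subst)

m+[1+t+m]≰m+m : ∀ m t → ¬ m + suc (t + m) ≤ m + m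
m+[1+t+m]≰m+m m t le = <-irrefl refl (<-≤-trans (+-monoʳ-< m (s≤s (m≤n+m m t))) le)

m+[1+t+m]≤1+m+m⇒t≡0 : ∀ m t → m + suc (t + m) ≤ suc (m + m) → t ≡ 0
m+[1+t+m]≤1+m+m⇒t≡0 m zero    _  = refl
m+[1+t+m]≤1+m+m⇒t≡0 m (suc t) le =
  ⊥-elim (m+[1+t+m]≰m+m m t (≤-pred (subst (_≤ suc (m + m)) (+-suc m (suc (t + m))) le)))

m+m≤1+n+n⇒m≤n : ∀ {m n} → m + m ≤ suc (n + n) → m ≤ n
m+m≤1+n+n⇒m≤n {m} {n} le with m ≤? n
... | yes m≤n = m≤n
... | no m≰n = ⊥-elim (m+[1+t+m]≰m+m n 0 (≤-pred (≤-trans (+-mono-≤ n<m n<m) le)))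
  where n<m = ≰⇒> m≰n

module _ {A : Set} where

  Unique-++⁻ˡ : ∀ {xs ys : List A} → Unique (xs ++ ys) → Unique xs
  Unique-++⁻ˡ {[]}     _         = []
  Unique-++⁻ˡ {x ∷ xs} (x∉ ∷ u) = ++⁻ˡ xs x∉ ∷ Unique-++⁻ˡ u

  Unique-++⁻ʳ : ∀ xs {ys : List A} → Unique (xs ++ ys) → Unique ys
  Unique-++⁻ʳ []       u       = u
  Unique-++⁻ʳ (x ∷ xs) (_ ∷ u) = Unique-++⁻ʳ xs u

  Unique-++⇒Disjoint : ∀ xs {ys : List A} → Unique (xs ++ ys) → Disjoint xs ys
  Unique-++⇒Disjoint (x ∷ xs) (x∉ ∷ _) (here refl , x∈ys) = All.lookup (++⁻ʳ xs x∉) x∈ys refl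
  Unique-++⇒Disjoint (x ∷ xs) (_ ∷ u)  (there z∈xs , z∈ys) = Unique-++⇒Disjoint xs u (z∈xs , z∈ys)

  Unique-concat⁻ : ∀ {xss : List (List A)} → Unique (concat xss) → All Unique xss × AllPairs Disjoint xss
  Unique-concat⁻ {[]}       _ = [] , []
  Unique-concat⁻ {xs ∷ xss} u =
    Unique-++⁻ˡ u ∷ proj₁ rest ,
    All.tabulate (λ ys∈xss (z∈xs , z∈ys) → Unique-++⇒Disjoint xs u (z∈xs , ∈-concat⁺′ z∈ys ys∈xss)) ∷ proj₂ rest
    where rest = Unique-concat⁻ (Unique-++⁻ʳ xs u)

  length-≤-⊆ : ∀ {xs ys : List A} → Unique xs → xs ⊆ ys → length xs ≤ length ys
  length-≤-⊆ {[]}     _        _     = z≤n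
  length-≤-⊆ {x ∷ xs} (x∉ ∷ u) xs⊆ys with ∈-∃++ (xs⊆ys (here refl))
  ... | as , bs , refl = begin
      suc (length xs)             ≤⟨ s≤s (length-≤-⊆ u xs⊆as++bs) ⟩
      suc (length (as ++ bs))     ≡⟨ cong suc (length-++ as) ⟩
      suc (length as + length bs) ≡⟨ +-suc (length as) (length bs) ⟨
      length as + length (x ∷ bs) ≡⟨ length-++ as ⟨
      length (as ++ x ∷ bs)       ∎
    where
    open ≤-Reasoning
    xs⊆as++bs : xs ⊆ as ++ bs
    xs⊆as++bs {z} z∈xs with ∈-++⁻ as (xs⊆ys (there z∈xs))
    ... | inj₁ z∈as         = ∈-++⁺ˡ z∈as
    ... | inj₂ (here refl)  = ⊥-elim (All.lookup x∉ z∈xs refl)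
    ... | inj₂ (there z∈bs) = ∈-++⁺ʳ as z∈bs

Unique⇒length≤ : ∀ {n} {xs : List (Fin n)} → Unique xs → length xs ≤ n
Unique⇒length≤ {n} u =
  ≤-trans (length-≤-⊆ u (λ {x} _ → ∈-allFin x)) (≤-reflexive (length-tabulate {n = n} (λ i → i)))

module _ {A : Set} (f : A → ℕ) where

  sum-≡0 : ∀ {xs} → All (λ a → f a ≡ 0) xs → sum (map f xs) ≡ 0
  sum-≡0 []             = refl
  sum-≡0 (fa≡0 ∷ fxs≡0) = cong₂ _+_ fa≡0 (sum-≡0 fxs≡0)

  sum-≤-one : ∀ {P : A → Set} {R : A → A → Set} {e xs} → All P xs → AllPairs R xs →
              (∀ {a b} → P a → P b → R a b → 0 < f a → 0 < f b → ⊥) →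
              (∀ {a} → P a → f a ≤ e) → sum (map f xs) ≤ e
  sum-≤-one [] [] _ _ = z≤n
  sum-≤-one {e = e} {a ∷ xs} (pa ∷ ps) (ra ∷ rs) excl bound with f a ≟ 0
  ... | yes fa≡0 = subst (λ m → m + sum (map f xs) ≤ e) (sym fa≡0) (sum-≤-one ps rs excl bound)
  ... | no fa≢0 = begin
      f a + sum (map f xs) ≡⟨ cong (f a +_) (sum-≡0 others≡0) ⟩
      f a + 0              ≡⟨ +-identityʳ (f a) ⟩
      f a                  ≤⟨ bound pa ⟩
      e                    ∎
    where
    open ≤-Reasoning
    others≡0 : All (λ b → f b ≡ 0) xs
    others≡0 = All.zipWith (λ (pb , rab) → (n≤0⇒n≡0 ∘ ≮⇒≥) (excl pa pb rab (n≢0⇒n>0 fa≢0))) (ps , ra)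

  sum-≤-two : ∀ {P : A → Set} {R : A → A → Set} {e xs} → All P xs → AllPairs R xs →
              (∀ {a b c} → P a → P b → P c → R a b → R a c → R b c → 0 < f a → 0 < f b → 0 < f c → ⊥) →
              (∀ {a b} → P a → P b → R a b → 0 < f a → 0 < f b → f a ≤ e × f b ≤ e) →
              (∀ {a} → P a → f a ≤ e + e) → sum (map f xs) ≤ e + e
  sum-≤-two [] [] _ _ _ = z≤n
  sum-≤-two {P} {R} {e} {a ∷ xs} (pa ∷ ps) (ra ∷ rs) excl pair bound with f a ≟ 0
  ... | yes fa≡0 = subst (λ m → m + sum (map f xs) ≤ e + e) (sym fa≡0) (sum-≤-two ps rs excl pair bound)
  ... | no fa≢0 with Any.any? (λ b → 0 <? f b) xs
  ...   | no none = begin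
      f a + sum (map f xs) ≡⟨ cong (f a +_) (sum-≡0 (All.map (n≤0⇒n≡0 ∘ ≮⇒≥) (¬Any⇒All¬ xs none))) ⟩
      f a + 0              ≡⟨ +-identityʳ (f a) ⟩
      f a                  ≤⟨ bound pa ⟩
      e + e                ∎
    where open ≤-Reasoning
  ...   | yes some with find some
  ...     | _ , b∈xs , fb>0 with All.lookup (All.zip (ps , ra)) b∈xs
  ...       | pb , rab = +-mono-≤ (proj₁ (pair pa pb rab fa>0 fb>0)) others≤e
    where
    fa>0 : 0 < f a
    fa>0 = n≢0⇒n>0 fa≢0
    others-bounded : ∀ {b} → P b × R a b → f b ≤ e
    others-bounded {b} (pb , rab) with f b ≟ 0
    ... | yes fb≡0 = subst (_≤ e) (sym fb≡0) z≤n
    ... | no fb≢0  = proj₂ (pair pa pb rab fa>0 (n≢0⇒n>0 fb≢0))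
    others≤e : sum (map f xs) ≤ e
    others≤e = sum-≤-one (All.zip (ps , ra)) rs
      (λ (pb , rab) (pc , rac) rbc → excl pa pb pc rab rac rbc fa>0) others-bounded

module Walks {n : ℕ} (G : Graph n) where

  open import Data.List.Membership.DecPropositional (_≟ᶠ_ {n}) using (_∈?_)

  private
    variable
      u v w x y z : Fin n
      k k₁ k₂ : ℕ

  entered : Walk G u v k → List (Fin n)
  entered here               = []
  entered (step {v = v} _ p) = v ∷ entered p

  vertices : Walk G u v k → List (Fin n)
  vertices {u = u} p = u ∷ entered p

  length-entered : (p : Walk G u v k) → length (entered p) ≡ k
  length-entered here       = refl
  length-entered (step _ p) = cong suc (length-entered p)

  vertices-linked : (p : Walk G u v k) → Linked (Adj G) (vertices p)
  vertices-linked here       = [-]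
  vertices-linked (step e p) = e ∷ vertices-linked p

  end∈vertices : (p : Walk G u v k) → v ∈ vertices p
  end∈vertices here       = here refl
  end∈vertices (step _ p) = there (end∈vertices p)

  Walk-0⇒≡ : Walk G u v 0 → u ≡ v
  Walk-0⇒≡ here = refl

  walkAlong : ∀ {x xs} → Linked (Adj G) (x ∷ xs) → ∃₂ λ y k → Σ (Walk G x y k) λ p → entered p ≡ xs
  walkAlong {xs = []}    _       = _ , _ , here , refl
  walkAlong {xs = _ ∷ _} (e ∷ L) with walkAlong L
  ... | _ , _ , p , refl = _ , _ , step e p , refl

  _++ʷ_ : Walk G u v k₁ → Walk G v w k₂ → Walk G u w (k₁ + k₂)
  here     ++ʷ q = q
  step e p ++ʷ q = step e (p ++ʷ q)

  entered-++ʷ : (p : Walk G u v k₁) (q : Walk G v w k₂) → entered (p ++ʷ q) ≡ entered p ++ entered q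
  entered-++ʷ here       q = refl
  entered-++ʷ (step _ p) q = cong (_ ∷_) (entered-++ʷ p q)

  ∈-++ʷ⁻ : (p : Walk G u v k₁) (q : Walk G v w k₂) → x ∈ vertices (p ++ʷ q) → x ∈ vertices p ⊎ x ∈ vertices q
  ∈-++ʷ⁻ here       q x∈      = inj₂ x∈
  ∈-++ʷ⁻ (step _ p) q (here refl) = inj₁ (here refl)
  ∈-++ʷ⁻ (step _ p) q (there x∈) with ∈-++ʷ⁻ p q x∈
  ... | inj₁ x∈p = inj₁ (there x∈p)
  ... | inj₂ x∈q = inj₂ x∈q

  Unique-++ʷ : (p : Walk G u y k₁) (q : Walk G y v k₂) → Unique (vertices p) → Unique (vertices q) →
               (∀ {z} → z ∈ vertices p → z ∈ vertices q → z ≡ y) → Unique (vertices (p ++ʷ q))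
  Unique-++ʷ {u = u} p q up (y∉ ∷ uq) meet = subst (λ zs → Unique (u ∷ zs)) (sym (entered-++ʷ p q))
    (++⁺ up uq λ (z∈p , z∈q) → All.lookup y∉ z∈q (sym (meet z∈p (there z∈q))))

  Unique-++ʷ-across : {A : Fin n → Set} (p : Walk G u x k₁) (e : Adj G x y) (q : Walk G y v k₂) →
                      Unique (vertices p) → (∀ {z} → z ∈ vertices p → A z) →
                      Unique (vertices q) → (∀ {z} → z ∈ vertices q → ¬ A z) →
                      Unique (vertices (p ++ʷ step e q))
  Unique-++ʷ-across p e q up p⊆A uq q∩A=∅ = Unique-++ʷ p (step e q) up
    (All.tabulate (λ z∈q x≡z → q∩A=∅ z∈q (subst _ x≡z (p⊆A (end∈vertices p)))) ∷ uq)
    λ { _ (here refl) → refl ; z∈p (there z∈q) → ⊥-elim (q∩A=∅ z∈q (p⊆A z∈p)) }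

  snoc : Walk G u v k → Adj G v w → Walk G u w (suc k)
  snoc here       e = step e here
  snoc (step f p) e = step f (snoc p e)

  reverseʷ : Walk G u v k → Walk G v u k
  reverseʷ here       = here
  reverseʷ (step e p) = snoc (reverseʷ p) (Graph.sym G e)

  vertices-snoc : (p : Walk G u v k) (e : Adj G v w) → vertices (snoc p e) ≡ vertices p ++ [ w ]
  vertices-snoc here       e = refl
  vertices-snoc {u = u} (step _ p) e = cong (u ∷_) (vertices-snoc p e)

  ∈-reverseʷ⁻ : (p : Walk G u v k) → x ∈ vertices (reverseʷ p) → x ∈ vertices p
  ∈-reverseʷ⁻ here x∈ = x∈
  ∈-reverseʷ⁻ {x = x} (step e p) x∈
    with ∈-++⁻ (vertices (reverseʷ p)) (subst (x ∈_) (vertices-snoc (reverseʷ p) (Graph.sym G e)) x∈)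
  ... | inj₁ x∈p        = there (∈-reverseʷ⁻ p x∈p)
  ... | inj₂ (here refl) = here refl

  Unique-reverseʷ : (p : Walk G u v k) → Unique (vertices p) → Unique (vertices (reverseʷ p))
  Unique-reverseʷ here       up        = up
  Unique-reverseʷ (step e p) (u∉ ∷ up) = subst Unique (sym (vertices-snoc (reverseʷ p) (Graph.sym G e)))
    (++⁺ (Unique-reverseʷ p up) ([] ∷ []) λ { (z∈p , here refl) → All.lookup u∉ (∈-reverseʷ⁻ p z∈p) refl })

  record Split (p : Walk G u v k) (z : Fin n) : Set where
    constructor mkSplit
    field
      i j           : ℕ
      prefix        : Walk G u z i
      suffix        : Walk G z v j
      lengths       : i + j ≡ k
      entered-split : entered p ≡ entered prefix ++ entered suffix
  open Split

  splitAt : (p : Walk G u v k) → z ∈ vertices p → Split p z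
  splitAt here       (here refl) = mkSplit 0 0 here here refl refl
  splitAt (step e p) (here refl) = mkSplit 0 _ here (step e p) refl refl
  splitAt (step e p) (there z∈)  with splitAt p z∈
  ... | mkSplit i j pre suf len split = mkSplit (suc i) j (step e pre) suf (cong suc len) (cong (_ ∷_) split)

  module _ {p : Walk G u v k} (s : Split p z) where

    prefix⊆ : vertices (prefix s) ⊆ vertices p
    prefix⊆ x∈ rewrite entered-split s = ∈-++⁺ˡ x∈

    suffix⊆ : vertices (suffix s) ⊆ vertices p
    suffix⊆ (here refl) rewrite entered-split s = ∈-++⁺ˡ (end∈vertices (prefix s))
    suffix⊆ (there x∈)  rewrite entered-split s = ∈-++⁺ʳ (u ∷ entered (prefix s)) x∈

    Unique-prefix : Unique (vertices p) → Unique (vertices (prefix s))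
    Unique-prefix up rewrite entered-split s = Unique-++⁻ˡ {xs = u ∷ entered (prefix s)} up

    Unique-suffix : Unique (vertices p) → Unique (vertices (suffix s))
    Unique-suffix up rewrite entered-split s =
      All.tabulate (λ x∈ z≡x → Unique-++⇒Disjoint (u ∷ entered (prefix s)) up
                                  (subst (_∈ vertices (prefix s)) z≡x (end∈vertices (prefix s)) , x∈))
      ∷ Unique-++⁻ʳ (u ∷ entered (prefix s)) up

  -- Induction on the other walk, whose first edge is u u₁. If u₁ is on p, the part of p up
  -- to u₁ is that edge or closes a cycle with it; otherwise the edge u₁ u followed by p is simple.
  simple⇒shortest : Acyclic G → Walk G u v k₁ → (p : Walk G u v k₂) → Unique (vertices p) → k₂ ≤ k₁
  simple⇒shortest ac here here       _         = z≤n
  simple⇒shortest ac here (step _ p) (u∉ ∷ _) = ⊥-elim (All.lookup u∉ (end∈vertices p) refl)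
  simple⇒shortest ac (step {v = u₁} e q) p up with u₁ ∈? vertices p
  ... | no u₁∉p = m≤n⇒m≤1+n (≤-trans (n≤1+n _)
                    (simple⇒shortest ac q (step (Graph.sym G e) p) (¬Any⇒All¬ _ u₁∉p ∷ up)))
  ... | yes u₁∈p with splitAt p u₁∈p
  ...   | mkSplit 0 _ here _ _ _ = ⊥-elim (Graph.irrefl G e)
  ...   | s@(mkSplit 1 _ _ _ refl _) = s≤s (simple⇒shortest ac q (suffix s) (Unique-suffix s up))
  ...   | s@(mkSplit (suc (suc _)) _ pre _ _ _) = ⊥-elim (ac _ (entered pre)
          ( Unique-prefix s up
          , subst (2 ≤_) (sym (length-entered pre)) (s≤s (s≤s z≤n))
          , subst (λ zs → Linked (Adj G) (_ ∷ zs)) (entered-++ʷ pre closing)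
                  (vertices-linked (pre ++ʷ closing))))
    where closing = step (Graph.sym G e) here

  record Arm (P : List (Fin n)) (z : Fin n) (l : ℕ) : Set where
    constructor mkArm
    field
      {start} : Fin n
      walk    : Walk G start z l
      simple  : Unique (vertices walk)
      inside  : vertices walk ⊆ P

  -- z cuts P into two pieces ending at z; the longer one is an arm covering half of P.
  longestArm : ∀ {P} → Linked (Adj G) P → Unique P → z ∈ P → ∃ λ l → Arm P z l × length P ≤ suc (l + l)
  longestArm {P = _ ∷ _} L U z∈P with walkAlong L
  ... | _ , _ , p , refl with splitAt p z∈P
  ...   | s@(mkSplit i j pre suf len _) with j ≤? i
  ...     | yes j≤i = i , mkArm pre (Unique-prefix s U) (prefix⊆ s) ,
                      s≤s (subst (_≤ i + i) (trans len (sym (length-entered p))) (+-monoʳ-≤ i j≤i))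
  ...     | no j≰i = j , mkArm (reverseʷ suf) (Unique-reverseʷ suf (Unique-suffix s U))
                                   (suffix⊆ s ∘ ∈-reverseʷ⁻ suf) ,
                      s≤s (subst (_≤ j + j) (trans len (sym (length-entered p))) (+-monoˡ-≤ j (<⇒≤ (≰⇒> j≰i))))

  record FirstHit (B : Fin n → Set) (p : Walk G u v k) : Set where
    constructor mkFirstHit
    field
      {end}    : Fin n
      {steps}  : ℕ
      walk     : Walk G u end steps
      hit      : B end
      simple   : Unique (vertices walk)
      only-end : All (λ z → B z → z ≡ end) (vertices walk)
      inside   : vertices walk ⊆ vertices p

  firstHit : {B : Fin n → Set} → (∀ z → Dec (B z)) → (p : Walk G u v k) → B v → FirstHit B p
  firstHit B? here Bv = mkFirstHit here Bv ([] ∷ []) ((λ _ → refl) ∷ []) (λ x∈ → x∈)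
  firstHit {u = u} B? (step e p) Bv with B? u
  ... | yes Bu = mkFirstHit here Bu ([] ∷ []) ((λ _ → refl) ∷ []) λ { (here refl) → here refl }
  ... | no ¬Bu with firstHit B? p Bv
  ...   | mkFirstHit c Bend uc only-end c⊆p with u ∈? vertices c
  ...     | yes u∈c = let s = splitAt c u∈c in
            mkFirstHit (suffix s) Bend (Unique-suffix s uc) (All.tabulate (All.lookup only-end ∘ suffix⊆ s))
                       (there ∘ c⊆p ∘ suffix⊆ s)
  ...     | no u∉c = mkFirstHit (step e c) Bend (¬Any⇒All¬ _ u∉c ∷ uc) ((λ Bu → ⊥-elim (¬Bu Bu)) ∷ only-end)
                       λ { (here refl) → here refl ; (there x∈) → there (c⊆p x∈) }

  record Bridge (A B : Fin n → Set) : Set where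
    constructor mkBridge
    field
      {s s′ t} : Fin n
      {steps}  : ℕ
      As       : A s
      edge     : Adj G s s′
      walk     : Walk G s′ t steps
      Bt       : B t
      simple   : Unique (vertices walk)
      only-end : All (λ z → B z → z ≡ t) (vertices walk)
      avoids   : All (λ z → ¬ A z) (vertices walk)

  -- The last edge of p leaving A, followed by the first hit of B after it.
  bridge : {A B : Fin n → Set} → (∀ z → Dec (A z)) → (∀ z → Dec (B z)) → (∀ {z} → A z → ¬ B z) →
           (p : Walk G u v k) → Any A (vertices p) → B v → Bridge A B
  bridge A? B? A∩B=∅ here (here Av) Bv = ⊥-elim (A∩B=∅ Av Bv)
  bridge A? B? A∩B=∅ (step e p) A∈ Bv with Any.any? A? (vertices p)
  ... | yes A∈p = bridge A? B? A∩B=∅ p A∈p Bv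
  ... | no A∉p with A∈
  ...   | there A∈p = ⊥-elim (A∉p A∈p)
  ...   | here Au with firstHit B? p Bv
  ...     | mkFirstHit c By uc only-end c⊆p =
            mkBridge Au e c By uc only-end (All.tabulate (All.lookup (¬Any⇒All¬ _ A∉p) ∘ c⊆p))

  simplify : (q : Walk G u v k) → ∃ λ k′ → Σ (Walk G u v k′) λ c → Unique (vertices c) × vertices c ⊆ vertices q
  simplify {v = v} q with firstHit (_≟ᶠ v) q refl
  ... | mkFirstHit c refl uc _ c⊆q = _ , c , uc , c⊆q

  simpleWalkWithin : ∀ {P} → Linked (Adj G) P → x ∈ P → y ∈ P →
                     ∃ λ k → Σ (Walk G x y k) λ c → Unique (vertices c) × vertices c ⊆ P
  simpleWalkWithin {P = _ ∷ _} L x∈P y∈P with walkAlong L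
  ... | _ , _ , p , refl =
    let k , c , uc , c⊆ = simplify (suffix sx ++ʷ reverseʷ (suffix sy))
    in  k , c , uc , λ z∈c → [ suffix⊆ sx , suffix⊆ sy ∘ ∈-reverseʷ⁻ (suffix sy) ]′ (∈-++ʷ⁻ (suffix sx) _ (c⊆ z∈c))
    where
    sx = splitAt p x∈P
    sy = splitAt p y∈P

Long : ∀ {A : Set} → ℕ → List A → Set
Long r P = r + r ≤ length P

surplus : ∀ {A : Set} → ℕ → List A → ℕ
surplus m P = length P ∸ m

module _ {A : Set} {P : List A} where

  surplus-≤ : ∀ {j m} → length P ≤ j + m → surplus m P ≤ j
  surplus-≤ {j} {m} le = subst (surplus m P ≤_) (m+n∸n≡m j m) (∸-monoˡ-≤ m le)

  positive-surplus⇒Long : ∀ {r k} → r + r ≡ suc (suc k) → 0 < surplus (suc k) P → Long r P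
  positive-surplus⇒Long {k = k} r+r≡ pos with length P ≤? suc k
  ... | yes short = ⊥-elim (<-irrefl (sym (m≤n⇒m∸n≡0 short)) pos)
  ... | no long   = subst (_≤ length P) (sym r+r≡) (≰⇒> long)

m+m≡2+k⇒0<m : ∀ {m k} → m + m ≡ suc (suc k) → 0 < m
m+m≡2+k⇒0<m {suc m} _ = s≤s z≤n

path-edges : ∀ k p → suc k * (p ∸ 1) ≤ k * p + (p ∸ suc k)
path-edges k zero    = m≤m+n (k * 0) 0
path-edges k (suc p) = begin
  suc k * p             ≡⟨ solve 2 (λ k p → (con 1 :+ k) :* p := p :+ k :* p) refl k p ⟩
  p + k * p             ≤⟨ +-monoˡ-≤ (k * p) (m≤n+m∸n p k) ⟩
  k + (p ∸ k) + k * p   ≡⟨ solve 3 (λ k e p → (k :+ e) :+ k :* p := k :* (con 1 :+ p) :+ e) refl k (p ∸ k) p ⟩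
  k * suc p + (p ∸ k)   ∎
  where
  open ≤-Reasoning
  open +-*-Solver

forest-edges : ∀ {A : Set} k (ps : List (List A)) →
               suc k * sum (map (λ p → length p ∸ 1) ps) ≤ k * length (concat ps) + sum (map (surplus (suc k)) ps)
forest-edges k []       = m≤m+n (k * 0) 0
forest-edges k (P ∷ ps) = begin
  suc k * (length P ∸ 1 + E)
    ≡⟨ *-distribˡ-+ (suc k) (length P ∸ 1) E ⟩
  suc k * (length P ∸ 1) + suc k * E
    ≤⟨ +-mono-≤ (path-edges k (length P)) (forest-edges k ps) ⟩
  (k * length P + surplus (suc k) P) + (k * length (concat ps) + S)
    ≡⟨ solve 5 (λ k a b c e → (k :* a :+ b) :+ (k :* c :+ e) := k :* (a :+ c) :+ (b :+ e)) refl
             k (length P) (surplus (suc k) P) (length (concat ps)) S ⟩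
  k * (length P + length (concat ps)) + (surplus (suc k) P + S)
    ≡⟨ cong (λ l → k * l + (surplus (suc k) P + S)) (length-++ P) ⟨
  k * length (P ++ concat ps) + (surplus (suc k) P + S) ∎
  where
  open ≤-Reasoning
  open +-*-Solver
  E = sum (map (λ p → length p ∸ 1) ps)
  S = sum (map (surplus (suc k)) ps)

[1+k]*m≤o⇒m≤o/[1+k] : ∀ {k m o} → suc k * m ≤ o → m ≤ o / suc k
[1+k]*m≤o⇒m≤o/[1+k] {k} {m} {o} le =
  subst (_≤ o / suc k) (m*n/n≡m m (suc k)) (/-monoˡ-≤ (suc k) (subst (_≤ o) (*-comm (suc k) m) le))

edges≤ : ∀ {n} (G : Graph n) k e (F : LinearForest G) →
         sum (map (surplus (suc k)) (LinearForest.paths F)) ≤ e →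
         edges G F ≤ (k * n + e) / suc k
edges≤ {n} G k e F surplus≤e = [1+k]*m≤o⇒m≤o/[1+k] (≤-trans (forest-edges k ps)
  (+-mono-≤ (*-monoʳ-≤ k (Unique⇒length≤ (LinearForest.disjoint F))) surplus≤e))
  where ps = LinearForest.paths F

module BoundedTree {n : ℕ} (G : Graph n) (acyclic : Acyclic G) (connected : Connected G)
                   {d : ℕ} (diameter≤ : ∀ u v k → Dist G u v k → k ≤ d) where

  open Walks G
  open import Data.List.Membership.DecPropositional (_≟ᶠ_ {n}) using (_∈?_)

  private
    variable
      u v : Fin n
      k a b r : ℕ
      P Q R : List (Fin n)

  SimplePath : List (Fin n) → Set
  SimplePath P = Linked (Adj G) P × Unique P

  simple-length≤ : {p : Walk G u v k} → Unique (vertices p) → k ≤ d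
  simple-length≤ {p = p} up = diameter≤ _ _ _ (p , λ j j<k q → <⇒≱ j<k (simple⇒shortest acyclic q p up))

  path-length≤ : SimplePath P → length P ≤ suc d
  path-length≤ {[]}    _       = z≤n
  path-length≤ {_ ∷ _} (L , U) with walkAlong L
  ... | _ , _ , p , refl = s≤s (subst (_≤ d) (sym (length-entered p)) (simple-length≤ U))

  -- An arm of P, a bridge of ℓ + 1 edges meeting P and Q only at its ends, and an arm of Q
  -- form a simple walk, so together they have at most d edges.
  link-gap : 0 < a → 0 < b → SimplePath P → SimplePath Q → Disjoint P Q → Long a P → Long b Q →
             ∃₂ λ x y → x ∈ P × y ∈ Q × ∃ λ ℓ → (ℓ ≡ 0 → Adj G x y) × a + suc (ℓ + b) ≤ d
  link-gap {P = []}              (s≤s _) _       _ _ _ () _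
  link-gap {P = _ ∷ _} {Q = []}  _       (s≤s _) _ _ _ _  ()
  link-gap {a = a} {b = b} {P = p₀ ∷ _} {Q = q₀ ∷ _} _ _ (LP , UP) (LQ , UQ) P∩Q=∅ a≤P b≤Q
    with bridge (_∈? _) (_∈? _) (λ x∈P x∈Q → P∩Q=∅ (x∈P , x∈Q))
                (proj₂ (connected p₀ q₀)) (here (here refl)) (here refl)
  ... | mkBridge {s} {s′} {t} {ℓ} s∈P e c t∈Q uc only-end avoids
    with longestArm LP UP s∈P | longestArm LQ UQ t∈Q
  ... | l₁ , mkArm h₁ uh₁ h₁⊆P , P≤ | l₂ , mkArm h₂ uh₂ h₂⊆Q , Q≤ =
    s , t , s∈P , t∈Q , ℓ , adjacent , (begin
      a + suc (ℓ + b)   ≤⟨ +-mono-≤ (m+m≤1+n+n⇒m≤n (≤-trans a≤P P≤))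
                                    (s≤s (+-monoʳ-≤ ℓ (m+m≤1+n+n⇒m≤n (≤-trans b≤Q Q≤)))) ⟩
      l₁ + suc (ℓ + l₂) ≤⟨ simple-length≤ simple ⟩
      d                 ∎)
    where
    open ≤-Reasoning
    adjacent : ℓ ≡ 0 → Adj G s t
    adjacent ℓ≡0 = subst (Adj G s) (Walk-0⇒≡ (subst (Walk G s′ t) ℓ≡0 c)) e
    outside : ∀ {z} → z ∈ vertices (c ++ʷ reverseʷ h₂) → z ∉ p₀ ∷ _
    outside z∈ z∈P with ∈-++ʷ⁻ c (reverseʷ h₂) z∈
    ... | inj₁ z∈c  = All.lookup avoids z∈c z∈P
    ... | inj₂ z∈h₂ = P∩Q=∅ (z∈P , h₂⊆Q (∈-reverseʷ⁻ h₂ z∈h₂))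
    simple : Unique (vertices (h₁ ++ʷ step e (c ++ʷ reverseʷ h₂)))
    simple = Unique-++ʷ-across h₁ e (c ++ʷ reverseʷ h₂) uh₁ h₁⊆P
      (Unique-++ʷ c (reverseʷ h₂) uc (Unique-reverseʷ h₂ uh₂)
         (λ z∈c z∈h₂ → All.lookup only-end z∈c (h₂⊆Q (∈-reverseʷ⁻ h₂ z∈h₂))))
      outside

  no-two-Long-paths : d ≡ r + r → 0 < r → SimplePath P → SimplePath Q → Disjoint P Q → Long r P → Long r Q → ⊥
  no-two-Long-paths {r} d≡ 0<r sP sQ P∩Q=∅ lP lQ =
    let _ , _ , _ , _ , ℓ , _ , gap = link-gap 0<r 0<r sP sQ P∩Q=∅ lP lQ
    in  m+[1+t+m]≰m+m r ℓ (≤-trans gap (≤-reflexive d≡))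

  module _ (d≡ : d ≡ suc (r + r)) (0<r : 0 < r) where

    Long-pair-length≤ : SimplePath P → SimplePath Q → Disjoint P Q → Long r P → Long r Q → length P ≤ d
    Long-pair-length≤ {P} sP sQ P∩Q=∅ lP lQ with length P ≤? d
    ... | yes P≤d = P≤d
    ... | no  P≰d =
      let _ , _ , _ , _ , ℓ , _ , gap = link-gap (s≤s z≤n) 0<r sP sQ P∩Q=∅ Long[1+r]P lQ
      in  ⊥-elim (m+[1+t+m]≰m+m r ℓ (≤-pred (≤-trans gap (≤-reflexive d≡))))
      where
      Long[1+r]P : Long (suc r) P
      Long[1+r]P = subst (_≤ length P) (cong suc (trans d≡ (sym (+-suc r r)))) (≰⇒> P≰d)

    Long-pair-adjacent : SimplePath P → SimplePath Q → Disjoint P Q → Long r P → Long r Q →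
                         ∃₂ λ x y → x ∈ P × y ∈ Q × Adj G x y
    Long-pair-adjacent sP sQ P∩Q=∅ lP lQ =
      let x , y , x∈P , y∈Q , ℓ , adjacent , gap = link-gap 0<r 0<r sP sQ P∩Q=∅ lP lQ
      in  x , y , x∈P , y∈Q , adjacent (m+[1+t+m]≤1+m+m⇒t≡0 r ℓ (≤-trans gap (≤-reflexive d≡)))

    -- Walk along an arm of P into x, across to Q, inside Q to y′, across to R and along an
    -- arm of R: a simple walk with at least r + 1 + 1 + r edges.
    no-three-Long-paths : SimplePath P → SimplePath Q → SimplePath R →
                          Disjoint P Q → Disjoint P R → Disjoint Q R → Long r P → Long r Q → Long r R → ⊥
    no-three-Long-paths {P} {Q} {R} sP@(LP , UP) sQ@(LQ , _) sR@(LR , UR) P∩Q=∅ P∩R=∅ Q∩R=∅ lP lQ lR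
      with Long-pair-adjacent sP sQ P∩Q=∅ lP lQ | Long-pair-adjacent sQ sR Q∩R=∅ lQ lR
    ... | x , y , x∈P , y∈Q , e | y′ , z , y′∈Q , z∈R , e′
      with simpleWalkWithin LQ y∈Q y′∈Q | longestArm LP UP x∈P | longestArm LR UR z∈R
    ... | ℓ , c , uc , c⊆Q | l₁ , mkArm h₁ uh₁ h₁⊆P , P≤ | l₃ , mkArm h₃ uh₃ h₃⊆R , R≤ =
      m+[1+t+m]≰m+m r ℓ (≤-pred (begin
        suc (r + suc (ℓ + r))  ≡⟨ +-suc r (suc (ℓ + r)) ⟨
        r + suc (suc (ℓ + r))  ≡⟨ cong (λ m → r + suc m) (+-suc ℓ r) ⟨
        r + suc (ℓ + suc r)    ≤⟨ +-mono-≤ (m+m≤1+n+n⇒m≤n (≤-trans lP P≤))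
                                    (s≤s (+-monoʳ-≤ ℓ (s≤s (m+m≤1+n+n⇒m≤n (≤-trans lR R≤))))) ⟩
        l₁ + suc (ℓ + suc l₃)  ≤⟨ simple-length≤ simple ⟩
        d                      ≡⟨ d≡ ⟩
        suc (r + r)            ∎))
      where
      open ≤-Reasoning
      tail = c ++ʷ step e′ (reverseʷ h₃)
      outside : ∀ {w} → w ∈ vertices tail → w ∉ P
      outside w∈ w∈P with ∈-++ʷ⁻ c (step e′ (reverseʷ h₃)) w∈
      ... | inj₁ w∈c          = P∩Q=∅ (w∈P , c⊆Q w∈c)
      ... | inj₂ (here refl)  = P∩Q=∅ (w∈P , y′∈Q)
      ... | inj₂ (there w∈h₃) = P∩R=∅ (w∈P , h₃⊆R (∈-reverseʷ⁻ h₃ w∈h₃))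
      simple : Unique (vertices (h₁ ++ʷ step e tail))
      simple = Unique-++ʷ-across h₁ e tail uh₁ h₁⊆P
        (Unique-++ʷ-across c e′ (reverseʷ h₃) uc c⊆Q (Unique-reverseʷ h₃ uh₃)
           (λ w∈h₃ w∈Q → Q∩R=∅ (w∈Q , h₃⊆R (∈-reverseʷ⁻ h₃ w∈h₃))))
        outside

  forest-paths : (F : LinearForest G) →
                 All SimplePath (LinearForest.paths F) × AllPairs Disjoint (LinearForest.paths F)
  forest-paths F = All.zip (LinearForest.arePaths F , proj₁ ps) , proj₂ ps
    where ps = Unique-concat⁻ (LinearForest.disjoint F)

  module _ {r k : ℕ} (r+r≡ : r + r ≡ suc (suc k)) where

    private
      0<r : 0 < r
      0<r = m+m≡2+k⇒0<m r+r≡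

      long : ∀ {P : List (Fin n)} → 0 < surplus (suc k) P → Long r P
      long {P} = positive-surplus⇒Long {P = P} {r = r} r+r≡

    surplus-even : d ≡ r + r → ∀ {ps} → All SimplePath ps → AllPairs Disjoint ps →
                   sum (map (surplus (suc k)) ps) ≤ 2
    surplus-even d≡ sps dps = sum-≤-one (surplus (suc k)) {e = 2} sps dps
      (λ {P} {Q} sP sQ P∩Q=∅ P>0 Q>0 → no-two-Long-paths d≡ 0<r sP sQ P∩Q=∅ (long {P} P>0) (long {Q} Q>0))
      (λ {P} sP → surplus-≤ {P = P} (≤-trans (path-length≤ sP) (≤-reflexive (cong suc (trans d≡ r+r≡)))))

    surplus-odd : d ≡ suc (r + r) → ∀ {ps} → All SimplePath ps → AllPairs Disjoint ps →
                  sum (map (surplus (suc k)) ps) ≤ 2 + 2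
    surplus-odd d≡ sps dps = sum-≤-two (surplus (suc k)) {e = 2} sps dps
      (λ {P} {Q} {R} sP sQ sR P∩Q=∅ P∩R=∅ Q∩R=∅ P>0 Q>0 R>0 →
         no-three-Long-paths d≡ 0<r sP sQ sR P∩Q=∅ P∩R=∅ Q∩R=∅ (long {P} P>0) (long {Q} Q>0) (long {R} R>0))
      (λ {P} {Q} sP sQ P∩Q=∅ P>0 Q>0 →
         surplus-≤ {P = P} (≤-trans (Long-pair-length≤ d≡ 0<r sP sQ P∩Q=∅ (long {P} P>0) (long {Q} Q>0)) d≤2+[1+k]) ,
         surplus-≤ {P = Q} (≤-trans (Long-pair-length≤ d≡ 0<r sQ sP (Disjoint-sym P∩Q=∅) (long {Q} Q>0) (long {P} P>0))
                                    d≤2+[1+k]))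
      (λ {P} sP → m≤n⇒m≤1+n (surplus-≤ {P = P} (≤-trans (path-length≤ sP) (s≤s d≤2+[1+k]))))
      where
      d≤2+[1+k] : d ≤ 2 + suc k
      d≤2+[1+k] = ≤-reflexive (trans d≡ (cong suc r+r≡))

    lAtMost-even : d ≡ r + r → lAtMost G ((k * n + 2) / suc k)
    lAtMost-even d≡ F = edges≤ G k 2 F (uncurry (surplus-even d≡) (forest-paths F))

    lAtMost-odd : d ≡ suc (r + r) → lAtMost G ((k * n + 4) / suc k)
    lAtMost-odd d≡ F = edges≤ G k 4 F (uncurry (surplus-odd d≡) (forest-paths F))

lAtLeast-Dist : ∀ {n} (G : Graph n) {u v d} → Dist G u v d → lAtLeast G d
lAtLeast-Dist G {d = d} (p , shortest) with Walks.simplify G p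
... | k , c , uc , _ = forest , subst (d ≤_) (sym (trans (+-identityʳ _) (Walks.length-entered G c))) d≤k
  where
  forest : LinearForest G
  forest = record { paths    = Walks.vertices G c ∷ []
                  ; arePaths = Walks.vertices-linked G c ∷ []
                  ; disjoint = subst Unique (sym (++-identityʳ _)) uc }
  d≤k : d ≤ k
  d≤k = ≮⇒≥ (λ k<d → shortest k k<d c)

m*2≡m+m : ∀ m → m * 2 ≡ m + m
m*2≡m+m m = trans (*-comm m 2) (cong (m +_) (+-identityʳ m))

even⇒≡half+half : ∀ d → d % 2 ≡ 0 → d ≡ d / 2 + d / 2
even⇒≡half+half d d%2≡0 = trans (m≡m%n+[m/n]*n d 2) (cong₂ _+_ d%2≡0 (m*2≡m+m (d / 2)))

odd⇒≡1+half+half : ∀ d → d % 2 ≡ 1 → d ≡ suc (d / 2 + d / 2)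
odd⇒≡1+half+half d d%2≡1 = trans (m≡m%n+[m/n]*n d 2) (cong₂ _+_ d%2≡1 (m*2≡m+m (d / 2)))

mainTheorem4 : ∀ {n : ℕ} (T : Graph n) (d : ℕ) → IsTree T → IsDiameter T d → 4 ≤ d →
      (d % 2 ≡ 0 → lAtLeast T d × lAtMost T (evenBound d n))
    × (d % 2 ≡ 1 → lAtLeast T d × lAtMost T (oddBound d n))
mainTheorem4 T d (connected , acyclic) ((_ , _ , far) , diameter≤) (s≤s (s≤s (s≤s (s≤s _)))) =
  (λ even → let d≡ = even⇒≡half+half d even in
            lAtLeast-Dist T far , lAtMost-even {r = d / 2} (sym d≡) d≡) ,
  (λ odd  → let d≡ = odd⇒≡1+half+half d odd in
            lAtLeast-Dist T far , lAtMost-odd {r = d / 2} (suc-injective (sym d≡)) d≡)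
  where open BoundedTree T acyclic connected diameter≤
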